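{- Let $k\geq 1$ and let $(C_1,C_2)$ be the type A partition of $\mathbb{Z}_2^{3k}$. Then the subgraph of the hypercube $H(3k,2)$ induced by $C_2$ is connected.
   Context: $H(n,2)$ is the graph on $\mathbb{Z}_2^n$ in which two vertices are adjacent iff they differ in exactly one coordinate. The type A partition $(C_1,C_2)$ of $\mathbb{Z}_2^{3k}$ is defined by: $x=(x_1,\ldots,x_{3k})\in C_1$ iff $\bigl(\sum_{i=1}^{k}x_i,\ \sum_{i=k+1}^{2k}x_i,\ \sum_{i=2k+1}^{3k}x_i\bigr)$ (sums mod 2) lies in $\{(0,0,0),(1,1,1)\}$, and $C_2=\mathbb{Z}_2^{3k}\setminus C_1$. -}

module Defs where

open import Data.Nat using (ℕ; zero; suc; _*_; _+_; _≤_; _<_; _≥_)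
open import Data.Nat.Properties using (_≤?_; _<?_)
open import Data.Bool using (Bool; true; false; _xor_; _∧_; not; if_then_else_)
open import Data.Fin using (Fin; toℕ)
open import Data.Vec using (Vec; lookup)
open import Data.Vec.Functional using () renaming (foldr to ffoldr)
open import Data.Product using (Σ; _×_; _,_; ∃-syntax)
open import Relation.Nullary using (¬_)
open import Relation.Nullary.Decidable using (⌊_⌋)
open import Relation.Binary.PropositionalEquality using (_≡_; _≢_)

Vertex : ℕ → Set
Vertex n = Vec Bool n

Adjacent : {n : ℕ} → Vertex n → Vertex n → Set
Adjacent {n} x y =
  Σ (Fin n) λ i → (lookup x i ≢ lookup y i) ×
    ((j : Fin n) → j ≢ i → lookup x j ≡ lookup y j)

rangeSum : {n : ℕ} → ℕ → ℕ → Vertex n → Bool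
rangeSum {n} a b x =
  ffoldr (λ b' acc → b' xor acc) false
    (λ i → (⌊ a ≤? toℕ i ⌋ ∧ ⌊ toℕ i <? b ⌋) ∧ lookup x i)

-- The three block sums of x ∈ Z_2^{3k} (blocks 1..k, k+1..2k, 2k+1..3k, 1-based).
s₁ s₂ s₃ : (k : ℕ) → Vertex (3 * k) → Bool
s₁ k x = rangeSum 0 k x
s₂ k x = rangeSum k (k + k) x
s₃ k x = rangeSum (k + k) (k + k + k) x

-- Type A partition: x ∈ C₁ iff (s₁,s₂,s₃) ∈ {(0,0,0),(1,1,1)}, C₂ the complement.
InC₁ : (k : ℕ) → Vertex (3 * k) → Set
InC₁ k x = (s₁ k x ≡ s₂ k x) × (s₂ k x ≡ s₃ k x)

InC₂ : (k : ℕ) → Vertex (3 * k) → Set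
InC₂ k x = ¬ InC₁ k x

data Walk {n : ℕ} (P : Vertex n → Set) : Vertex n → Vertex n → Set where
  stay : ∀ {x} → P x → Walk P x x
  step : ∀ {x y z} → P x → Adjacent x y → Walk P y z → Walk P x z

InducedConnected : {n : ℕ} → (Vertex n → Set) → Set
InducedConnected {n} P = (x y : Vertex n) → P x → P y → Walk P x y

{-# OPTIONS --safe #-}
-- C₁ is the preimage of the subgroup {000, 111} of ℤ₂³ under x ↦ (s₁, s₂, s₃), and flipping a
-- coordinate adds the unit vector of its block. To join x to y inside C₂, correct the coordinates
-- one at a time. If correcting coordinate i (block vector u) would enter C₁, first flip a
-- not yet corrected coordinate q of another block (vector v): when u + t is constant, v + t and
-- u + v + t differ from a constant by u + v and by v, which are not constant, so both steps stay
-- in C₂. Correcting every coordinate and then one coordinate of block 3 and one of block 1 ensures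
-- that such a q is always available.

module Submission where

open import Defs
open import Data.Nat using (ℕ; zero; suc; _*_; _+_; _≤_; _<_; _≥_; z≤n)
open import Data.Nat.Properties
  using (_≤?_; _<?_; ≤-refl; ≤-trans; <-≤-trans; m≤m+n; m<m+n; <⇒≱; ≤⇒≯; <-≤-connex;
         +-assoc; +-identityʳ)
open import Data.Bool using (Bool; true; false; _xor_; _∧_; not)
open import Data.Bool.Properties
  using (_≟_; ∧-distribˡ-xor; xor-inverseʳ; ∧-identityʳ; ∧-zeroʳ; not-¬; ¬-not)
open import Data.Bool.Solver using (module xor-∧-Solver)
open xor-∧-Solver using (solve; _:+_; _:=_)
open import Data.Fin using (Fin; toℕ; fromℕ<) renaming (zero to fzero; suc to fsuc)
open import Data.Fin.Properties using (toℕ<n; toℕ-fromℕ<; suc-injective) renaming (_≟_ to _≟ᶠ_)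
open import Data.Vec using (lookup; updateAt)
open import Data.Vec.Properties using (lookup∘updateAt; lookup∘updateAt′)
open import Data.Vec.Relation.Binary.Pointwise.Extensional using (ext; Pointwise-≡⇒≡)
open import Data.Vec.Functional using () renaming (foldr to ffoldr)
open import Data.List using (List; []; _∷_; _++_; allFin)
open import Data.List.Membership.Propositional using (_∈_)
open import Data.List.Membership.Propositional.Properties using (∈-++⁺ˡ; ∈-++⁺ʳ; ∈-allFin)
open import Data.List.Relation.Unary.Any using (here; there)
open import Data.Product using (_×_; _,_)
open import Data.Sum using (_⊎_; inj₁; inj₂; fromInj₁; map₁)
open import Function using (_∘_)
open import Relation.Nullary using (¬_; Dec; yes; no)
open import Relation.Nullary.Decidable using (⌊_⌋; isYes≗does; dec-true; dec-false; _×-dec_)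
open import Relation.Binary.PropositionalEquality
  using (_≡_; _≢_; refl; sym; trans; cong; cong₂; subst; subst₂; module ≡-Reasoning)

flipAt : ∀ {n} → Vertex n → Fin n → Vertex n
flipAt x i = updateAt x i not

adjacent-flipAt : ∀ {n} (x : Vertex n) i → Adjacent x (flipAt x i)
adjacent-flipAt x i = i , xᵢ≢ , λ j j≢i → sym (lookup∘updateAt′ j i j≢i x)
  where
  xᵢ≢ : lookup x i ≢ lookup (flipAt x i) i
  xᵢ≢ e = not-¬ refl (trans e (lookup∘updateAt i x))

≡⇒walk : ∀ {n} {P : Vertex n → Set} {z y} → z ≡ y → P y → Walk P z y
≡⇒walk refl = stay

record AgreeOutside {n} (L : List (Fin n)) (z y : Vertex n) : Set where
  field agreesAt : (j : Fin n) → lookup z j ≡ lookup y j ⊎ j ∈ L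

open AgreeOutside

module _ {n : ℕ} {y : Vertex n} where

  agreeOutside-[] : ∀ {z} → AgreeOutside [] z y → z ≡ y
  agreeOutside-[] agree = Pointwise-≡⇒≡ (ext λ j → fromInj₁ (λ ()) (agreesAt agree j))

  agreeOutside-∷ : ∀ {z i L} → lookup z i ≡ lookup y i →
                   AgreeOutside (i ∷ L) z y → AgreeOutside L z y
  agreesAt (agreeOutside-∷ zᵢ≡yᵢ agree) j with agreesAt agree j
  ... | inj₁ zⱼ≡yⱼ       = inj₁ zⱼ≡yⱼ
  ... | inj₂ (here refl) = inj₁ zᵢ≡yᵢ
  ... | inj₂ (there j∈L) = inj₂ j∈L

  agreeOutside-flipAt : ∀ {z q L} → q ∈ L → AgreeOutside L z y → AgreeOutside L (flipAt z q) y
  agreesAt (agreeOutside-flipAt {z} {q} q∈L agree) j with j ≟ᶠ q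
  ... | yes refl = inj₂ q∈L
  ... | no j≢q   = map₁ (trans (lookup∘updateAt′ j q j≢q z)) (agreesAt agree j)

  agreeOutside-∷-flipAt : ∀ {z i L} → lookup z i ≢ lookup y i →
                          AgreeOutside (i ∷ L) z y → AgreeOutside L (flipAt z i) y
  agreeOutside-∷-flipAt {z} {i} zᵢ≢yᵢ agree =
    agreeOutside-∷ (trans (lookup∘updateAt i z) (sym (¬-not (zᵢ≢yᵢ ∘ sym))))
                   (agreeOutside-flipAt (here refl) agree)

module _ {n : ℕ} (P : Vertex n → Set) where

  Detour : Fin n → Fin n → Set
  Detour i q = ∀ z → P z → P (flipAt z i) ⊎ (P (flipAt z q) × P (flipAt (flipAt z q) i))

  data Schedule : List (Fin n) → Set where
    final : ∀ i → Schedule (i ∷ [])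
    via   : ∀ {i q L} → q ∈ L → i ≢ q → Detour i q → Schedule L → Schedule (i ∷ L)

  walk-along : ∀ {L y z} → Schedule L → P y → P z → AgreeOutside L z y → Walk P z y
  walk-along {y = y} {z} (final i) y∈P z∈P agree with lookup z i ≟ lookup y i
  ... | yes zᵢ≡yᵢ = ≡⇒walk (agreeOutside-[] (agreeOutside-∷ zᵢ≡yᵢ agree)) y∈P
  ... | no zᵢ≢yᵢ  =
    step z∈P (adjacent-flipAt z i)
      (≡⇒walk (agreeOutside-[] (agreeOutside-∷-flipAt zᵢ≢yᵢ agree)) y∈P)
  walk-along {y = y} {z} (via {i} {q} q∈L i≢q detour schedule) y∈P z∈P agree
    with lookup z i ≟ lookup y i | detour z z∈P
  ... | yes zᵢ≡yᵢ | _ = walk-along schedule y∈P z∈P (agreeOutside-∷ zᵢ≡yᵢ agree)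
  ... | no zᵢ≢yᵢ | inj₁ zⁱ∈P =
    step z∈P (adjacent-flipAt z i)
      (walk-along schedule y∈P zⁱ∈P (agreeOutside-∷-flipAt zᵢ≢yᵢ agree))
  ... | no zᵢ≢yᵢ | inj₂ (zᵠ∈P , zᵠⁱ∈P) =
    step z∈P (adjacent-flipAt z q) (step zᵠ∈P (adjacent-flipAt (flipAt z q) i)
      (walk-along schedule y∈P zᵠⁱ∈P
        (agreeOutside-∷-flipAt zᵠᵢ≢yᵢ (agreeOutside-flipAt (there q∈L) agree))))
    where
    zᵠᵢ≢yᵢ : lookup (flipAt z q) i ≢ lookup y i
    zᵠᵢ≢yᵢ = zᵢ≢yᵢ ∘ trans (sym (lookup∘updateAt′ i q i≢q z))

xorSum : ∀ {n} → (Fin n → Bool) → Bool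
xorSum = ffoldr _xor_ false

xorSum-cong : ∀ {n} {f g : Fin n → Bool} → (∀ j → f j ≡ g j) → xorSum f ≡ xorSum g
xorSum-cong {zero} f≗g = refl
xorSum-cong {suc n} f≗g = cong₂ _xor_ (f≗g fzero) (xorSum-cong (f≗g ∘ fsuc))

xorSum-update : ∀ {n} (f g : Fin n → Bool) i → (∀ j → j ≢ i → f j ≡ g j) →
                xorSum g ≡ (f i xor g i) xor xorSum f
xorSum-update f g fzero f≗g =
  trans (cong (g fzero xor_) (sym (xorSum-cong λ j → f≗g (fsuc j) λ ())))
        (exchange (f fzero) (g fzero) (xorSum (f ∘ fsuc)))
  where
  exchange : ∀ a b s → b xor s ≡ (a xor b) xor (a xor s)
  exchange = solve 3 (λ a b s → b :+ s := (a :+ b) :+ (a :+ s)) refl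
xorSum-update f g (fsuc i) f≗g =
  trans (cong₂ _xor_ (sym (f≗g fzero λ ())) (xorSum-update (f ∘ fsuc) (g ∘ fsuc) i f≗g-tail))
        (swap (f fzero) (f (fsuc i) xor g (fsuc i)) (xorSum (f ∘ fsuc)))
  where
  f≗g-tail : ∀ j → j ≢ i → f (fsuc j) ≡ g (fsuc j)
  f≗g-tail j j≢i = f≗g (fsuc j) (j≢i ∘ suc-injective)
  swap : ∀ a d s → a xor (d xor s) ≡ d xor (a xor s)
  swap = solve 3 (λ a d s → a :+ (d :+ s) := d :+ (a :+ s)) refl

inRange : ∀ {n} → ℕ → ℕ → Fin n → Bool
inRange a b i = ⌊ a ≤? toℕ i ⌋ ∧ ⌊ toℕ i <? b ⌋

rangeSum-flipAt : ∀ {n} a b (x : Vertex n) i →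
                  rangeSum a b (flipAt x i) ≡ inRange a b i xor rangeSum a b x
rangeSum-flipAt {n} a b x i = begin
  rangeSum a b (flipAt x i)
    ≡⟨ xorSum-update (λ j → c j ∧ lookup x j) (λ j → c j ∧ lookup (flipAt x i) j) i
         (λ j j≢i → cong (c j ∧_) (sym (lookup∘updateAt′ j i j≢i x))) ⟩
  ((c i ∧ lookup x i) xor (c i ∧ lookup (flipAt x i) i)) xor rangeSum a b x
    ≡⟨ cong (λ v → ((c i ∧ lookup x i) xor (c i ∧ v)) xor rangeSum a b x) (lookup∘updateAt i x) ⟩
  ((c i ∧ lookup x i) xor (c i ∧ not (lookup x i))) xor rangeSum a b x
    ≡⟨ cong (_xor rangeSum a b x) (sym (∧-distribˡ-xor (c i) (lookup x i) _)) ⟩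
  (c i ∧ (lookup x i xor not (lookup x i))) xor rangeSum a b x
    ≡⟨ cong (λ v → (c i ∧ v) xor rangeSum a b x) (xor-inverseʳ (lookup x i)) ⟩
  (c i ∧ true) xor rangeSum a b x
    ≡⟨ cong (_xor rangeSum a b x) (∧-identityʳ (c i)) ⟩
  c i xor rangeSum a b x ∎
  where
  open ≡-Reasoning
  c : Fin n → Bool
  c = inRange a b

isYes-true : ∀ {A : Set} (a? : Dec A) → A → ⌊ a? ⌋ ≡ true
isYes-true a? a = trans (isYes≗does a?) (dec-true a? a)

isYes-false : ∀ {A : Set} (a? : Dec A) → ¬ A → ⌊ a? ⌋ ≡ false
isYes-false a? ¬a = trans (isYes≗does a?) (dec-false a? ¬a)

inRange-inside : ∀ {n} a b {i : Fin n} → a ≤ toℕ i → toℕ i < b → inRange a b i ≡ true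
inRange-inside a b {i} a≤i i<b =
  cong₂ _∧_ (isYes-true (a ≤? toℕ i) a≤i) (isYes-true (toℕ i <? b) i<b)

inRange-below : ∀ {n} a b {i : Fin n} → toℕ i < a → inRange a b i ≡ false
inRange-below a b {i} i<a = cong (_∧ _) (isYes-false (a ≤? toℕ i) (<⇒≱ i<a))

inRange-above : ∀ {n} a b {i : Fin n} → b ≤ toℕ i → inRange a b i ≡ false
inRange-above a b {i} b≤i =
  trans (cong (⌊ a ≤? toℕ i ⌋ ∧_) (isYes-false (toℕ i <? b) (≤⇒≯ b≤i))) (∧-zeroʳ _)

Bool³ : Set
Bool³ = Bool × Bool × Bool

infixr 6 _⊕_
_⊕_ : Bool³ → Bool³ → Bool³
(a , b , c) ⊕ (a′ , b′ , c′) = a xor a′ , b xor b′ , c xor c′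

cong-triple : ∀ {a b c a′ b′ c′ : Bool} →
              a ≡ a′ → b ≡ b′ → c ≡ c′ → (a , b , c) ≡ (a′ , b′ , c′)
cong-triple a≡a′ b≡b′ c≡c′ = cong₂ _,_ a≡a′ (cong₂ _,_ b≡b′ c≡c′)

⊕-cancelʳ : ∀ u v t → (u ⊕ t) ⊕ (v ⊕ t) ≡ u ⊕ v
⊕-cancelʳ (u₁ , u₂ , u₃) (v₁ , v₂ , v₃) (t₁ , t₂ , t₃) =
  cong-triple (xor-cancelʳ u₁ v₁ t₁) (xor-cancelʳ u₂ v₂ t₂) (xor-cancelʳ u₃ v₃ t₃)
  where
  xor-cancelʳ : ∀ a b c → (a xor c) xor (b xor c) ≡ a xor b
  xor-cancelʳ = solve 3 (λ a b c → (a :+ c) :+ (b :+ c) := a :+ b) refl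

⊕-cancel : ∀ u v t → (u ⊕ t) ⊕ (u ⊕ v ⊕ t) ≡ v
⊕-cancel (u₁ , u₂ , u₃) (v₁ , v₂ , v₃) (t₁ , t₂ , t₃) =
  cong-triple (xor-cancel u₁ v₁ t₁) (xor-cancel u₂ v₂ t₂) (xor-cancel u₃ v₃ t₃)
  where
  xor-cancel : ∀ a b c → (a xor c) xor (a xor (b xor c)) ≡ b
  xor-cancel = solve 3 (λ a b c → (a :+ c) :+ (a :+ (b :+ c)) := b) refl

-- InC₁ k x unfolds to Constant (blockSums k x).
Constant : Bool³ → Set
Constant (a , b , c) = (a ≡ b) × (b ≡ c)

constant? : ∀ t → Dec (Constant t)
constant? (a , b , c) = (a ≟ b) ×-dec (b ≟ c)

constant-⊕ : ∀ {s t} → Constant s → Constant t → Constant (s ⊕ t)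
constant-⊕ (refl , refl) (refl , refl) = refl , refl

data UnitVector : Bool³ → Set where
  e₁ : UnitVector (true , false , false)
  e₂ : UnitVector (false , true , false)
  e₃ : UnitVector (false , false , true)

unitVector-≢e₃⊎≢e₁ : ∀ {u} → UnitVector u →
                     u ≢ (false , false , true) ⊎ u ≢ (true , false , false)
unitVector-≢e₃⊎≢e₁ e₁ = inj₁ λ ()
unitVector-≢e₃⊎≢e₁ e₂ = inj₁ λ ()
unitVector-≢e₃⊎≢e₁ e₃ = inj₂ λ ()

unitVector-nonconstant : ∀ {u} → UnitVector u → ¬ Constant u
unitVector-nonconstant e₁ (() , _)
unitVector-nonconstant e₂ (() , _)
unitVector-nonconstant e₃ (_ , ())

unitVectors-⊕-nonconstant : ∀ {u v} → UnitVector u → UnitVector v → u ≢ v → ¬ Constant (u ⊕ v)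
unitVectors-⊕-nonconstant e₁ e₁ u≢v _ = u≢v refl
unitVectors-⊕-nonconstant e₁ e₂ _ (_ , ())
unitVectors-⊕-nonconstant e₁ e₃ _ (() , _)
unitVectors-⊕-nonconstant e₂ e₁ _ (_ , ())
unitVectors-⊕-nonconstant e₂ e₂ u≢v _ = u≢v refl
unitVectors-⊕-nonconstant e₂ e₃ _ (() , _)
unitVectors-⊕-nonconstant e₃ e₁ _ (() , _)
unitVectors-⊕-nonconstant e₃ e₂ _ (() , _)
unitVectors-⊕-nonconstant e₃ e₃ u≢v _ = u≢v refl

hexagon-detour : ∀ {u v} t → UnitVector u → UnitVector v → u ≢ v →
                 ¬ Constant (u ⊕ t) ⊎ (¬ Constant (v ⊕ t) × ¬ Constant (u ⊕ v ⊕ t))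
hexagon-detour {u} {v} t u-unit v-unit u≢v with constant? (u ⊕ t)
... | no u⊕t≁ = inj₁ u⊕t≁
... | yes u⊕t∼ = inj₂
  ( (λ v⊕t∼ → unitVectors-⊕-nonconstant u-unit v-unit u≢v
                 (subst Constant (⊕-cancelʳ u v t) (constant-⊕ u⊕t∼ v⊕t∼)))
  , (λ u⊕v⊕t∼ → unitVector-nonconstant v-unit
                 (subst Constant (⊕-cancel u v t) (constant-⊕ u⊕t∼ u⊕v⊕t∼))) )

threefold : ∀ k → 3 * k ≡ k + k + k
threefold k = trans (cong (λ m → k + (k + m)) (+-identityʳ k)) (sym (+-assoc k k k))

module _ (k : ℕ) where

  blockSums : Vertex (3 * k) → Bool³
  blockSums x = s₁ k x , s₂ k x , s₃ k x

  blockVector : Fin (3 * k) → Bool³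
  blockVector i = inRange 0 k i , inRange k (k + k) i , inRange (k + k) (k + k + k) i

  blockSums-flipAt : ∀ x i → blockSums (flipAt x i) ≡ blockVector i ⊕ blockSums x
  blockSums-flipAt x i =
    cong-triple (rangeSum-flipAt 0 k x i) (rangeSum-flipAt k (k + k) x i)
                (rangeSum-flipAt (k + k) (k + k + k) x i)

  blockVector-first : ∀ i → toℕ i < k → blockVector i ≡ (true , false , false)
  blockVector-first i i<k =
    cong-triple (inRange-inside 0 k z≤n i<k) (inRange-below k (k + k) i<k)
                (inRange-below (k + k) (k + k + k) (<-≤-trans i<k (m≤m+n k k)))

  blockVector-second : ∀ i → k ≤ toℕ i → toℕ i < k + k → blockVector i ≡ (false , true , false)
  blockVector-second i k≤i i<2k =
    cong-triple (inRange-above 0 k k≤i) (inRange-inside k (k + k) k≤i i<2k)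
                (inRange-below (k + k) (k + k + k) i<2k)

  blockVector-third : ∀ i → k + k ≤ toℕ i → blockVector i ≡ (false , false , true)
  blockVector-third i 2k≤i =
    cong-triple (inRange-above 0 k (≤-trans (m≤m+n k k) 2k≤i)) (inRange-above k (k + k) 2k≤i)
                (inRange-inside (k + k) (k + k + k) 2k≤i (subst (toℕ i <_) (threefold k) (toℕ<n i)))

  blockVector-unitVector : ∀ i → UnitVector (blockVector i)
  blockVector-unitVector i with <-≤-connex (toℕ i) k | <-≤-connex (toℕ i) (k + k)
  ... | inj₁ i<k | _        = subst UnitVector (sym (blockVector-first i i<k)) e₁
  ... | inj₂ k≤i | inj₁ i<2k = subst UnitVector (sym (blockVector-second i k≤i i<2k)) e₂
  ... | inj₂ _   | inj₂ 2k≤i = subst UnitVector (sym (blockVector-third i 2k≤i)) e₃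

  inC₂-flipAt : ∀ x i → ¬ Constant (blockVector i ⊕ blockSums x) → InC₂ k (flipAt x i)
  inC₂-flipAt x i = subst (λ t → ¬ Constant t) (sym (blockSums-flipAt x i))

  inC₂-detour : ∀ {i q} → blockVector i ≢ blockVector q → Detour (InC₂ k) i q
  inC₂-detour {i} {q} i≁q z _
    with hexagon-detour (blockSums z) (blockVector-unitVector i) (blockVector-unitVector q) i≁q
  ... | inj₁ zⁱ≁ = inj₁ (inC₂-flipAt z i zⁱ≁)
  ... | inj₂ (zᵠ≁ , zᵠⁱ≁) =
    inj₂ (inC₂-flipAt z q zᵠ≁ , inC₂-flipAt (flipAt z q) i zᵠⁱ≁′)
    where
    zᵠⁱ≁′ : ¬ Constant (blockVector i ⊕ blockSums (flipAt z q))
    zᵠⁱ≁′ = subst (λ t → ¬ Constant (blockVector i ⊕ t)) (sym (blockSums-flipAt z q)) zᵠⁱ≁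

  viaOtherBlock : ∀ {i q L} → q ∈ L → blockVector i ≢ blockVector q →
                  Schedule (InC₂ k) L → Schedule (InC₂ k) (i ∷ L)
  viaOtherBlock q∈L i≁q = via q∈L (i≁q ∘ cong blockVector) (inC₂-detour i≁q)

module _ (k : ℕ) (k≥1 : k ≥ 1) where

  firstOfBlock₁ firstOfBlock₃ : Fin (3 * k)
  firstOfBlock₁ = fromℕ< (≤-trans k≥1 (m≤m+n k (2 * k)))
  firstOfBlock₃ = fromℕ< (subst (k + k <_) (sym (threefold k)) (m<m+n (k + k) k≥1))

  firstOfBlock₁-vector : blockVector k firstOfBlock₁ ≡ (true , false , false)
  firstOfBlock₁-vector =
    blockVector-first k firstOfBlock₁ (subst (_< k) (sym (toℕ-fromℕ< _)) k≥1)

  firstOfBlock₃-vector : blockVector k firstOfBlock₃ ≡ (false , false , true)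
  firstOfBlock₃-vector =
    blockVector-third k firstOfBlock₃ (subst (k + k ≤_) (sym (toℕ-fromℕ< _)) ≤-refl)

  anchors : List (Fin (3 * k))
  anchors = firstOfBlock₃ ∷ firstOfBlock₁ ∷ []

  schedule : ∀ L → Schedule (InC₂ k) (L ++ anchors)
  schedule [] =
    viaOtherBlock k (here refl)
      (subst₂ _≢_ (sym firstOfBlock₃-vector) (sym firstOfBlock₁-vector) λ ())
      (final firstOfBlock₁)
  schedule (i ∷ L) with unitVector-≢e₃⊎≢e₁ (blockVector-unitVector k i)
  ... | inj₁ i≢e₃ = viaOtherBlock k (∈-++⁺ʳ L (here refl))
                      (subst (blockVector k i ≢_) (sym firstOfBlock₃-vector) i≢e₃) (schedule L)
  ... | inj₂ i≢e₁ = viaOtherBlock k (∈-++⁺ʳ L (there (here refl)))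
                      (subst (blockVector k i ≢_) (sym firstOfBlock₁-vector) i≢e₁) (schedule L)

lemma6 : (k : ℕ) → k ≥ 1 → InducedConnected (InC₂ k)
lemma6 k k≥1 x y x∈C₂ y∈C₂ =
  walk-along (InC₂ k) (schedule k k≥1 (allFin (3 * k))) y∈C₂ x∈C₂ everyCoordinatePending
  where
  everyCoordinatePending : AgreeOutside (allFin (3 * k) ++ anchors k k≥1) x y
  everyCoordinatePending = record { agreesAt = λ j → inj₂ (∈-++⁺ˡ (∈-allFin j)) }
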